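{- Let $T$ be a tournament. There exists a $\delta$-decomposition $D$ of $T$ such that for every transitive component $C$ of $T$ with $|C| \geq 4$, we have $\{C(0), C(|C|-2)\} \subseteq D$.
   Context: A tournament $T$ is a finite vertex set $V(T)$ with an arc set $A(T)$ such that for all distinct $x,y$, exactly one of $(x,y),(y,x)$ lies in $A(T)$; it is transitive if $(x,y),(y,z)\in A(T)$ imply $(x,z)\in A(T)$. A module of $T$ is a subset $M$ such that for all $x,y \in M$ and $v \notin M$, $(v,x)\in A(T)$ iff $(v,y)\in A(T)$; trivial modules are $\emptyset$, singletons and $V(T)$. With $\overline{X} = V(T)\setminus X$, a co-module is a set $M$ such that $M$ or $\overline{M}$ is a nontrivial module; a co-modular decomposition is a set of pairwise disjoint co-modules; $\Delta(T)$ is the largest size of a co-modular decomposition. A minimal co-module is one containing no other co-module; ${\rm mc}(T)$ is the set of these. A $\delta$-decomposition is a co-modular decomposition $D$ with $|D|=\Delta(T)$ and $D\subseteq{\rm mc}(T)$. A transitive component of $T$ is a module $C$ with $T[C]$ transitive, maximal under inclusion among such modules. For a transitive component $C$ with $|C|=n\ge 2$ (in a tournament with at least three vertices), label its elements $v_0,\ldots,v_{n-1}$ so that $(v_i,v_j)\in A(T)$ whenever $i<j$; for each $k\in\{0,\ldots,n-2\}$, exactly one element of ${\rm mc}(T)$ lies in $\{\{v_k,v_{k+1}\},\{v_k\},\{v_{k+1}\}\}$, and it is denoted $C(k)$. -}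

module Defs where

open import Data.Nat using (ℕ; suc)
open import Data.Bool using (Bool; true; false; not)
open import Data.Fin using (Fin; zero; suc; _<_; fromℕ; inject₁)
open import Data.Fin.Subset using (Subset; _∈_; _∉_; _⊆_; ∁; ⁅_⁆; _∪_; ⊥; ⊤; ∣_∣)
open import Data.List using (List; length)
open import Data.List.Relation.Unary.All using (All)
open import Data.List.Relation.Unary.AllPairs using (AllPairs)
import Data.List.Membership.Propositional as LM
open import Data.Product using (Σ; ∃; _×_; _,_)
open import Data.Sum using (_⊎_)
open import Relation.Nullary using (¬_)
open import Relation.Binary.PropositionalEquality using (_≡_; _≢_)
import Data.Empty as E

-- A tournament on the vertex set Fin n; arc x y ≡ true means (x,y) ∈ A(T).
record Tournament (n : ℕ) : Set where
  field
    arc     : Fin n → Fin n → Bool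
    irrefl  : ∀ x → arc x x ≡ false
    tourn   : ∀ x y → x ≢ y → arc y x ≡ not (arc x y)
open Tournament public

module _ {n : ℕ} (T : Tournament n) where

  IsModule : Subset n → Set
  IsModule M = ∀ x y v → x ∈ M → y ∈ M → v ∉ M → arc T v x ≡ arc T v y

  Trivial : Subset n → Set
  Trivial M = (M ≡ ⊥) ⊎ (∣ M ∣ ≡ 1) ⊎ (M ≡ ⊤)

  IsNontrivialModule : Subset n → Set
  IsNontrivialModule M = IsModule M × ¬ Trivial M

  IsCoModule : Subset n → Set
  IsCoModule M = IsNontrivialModule M ⊎ IsNontrivialModule (∁ M)

  Disjoint : Subset n → Subset n → Set
  Disjoint X Y = ∀ x → x ∈ X → x ∈ Y → E.⊥

  -- a co-modular decomposition: a (finite) set of pairwise disjoint co-modules,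
  -- given as a list; pairwise disjointness of nonempty sets forces distinctness,
  -- so the length of the list is the size of the set.
  IsCoModularDecomposition : List (Subset n) → Set
  IsCoModularDecomposition D = All IsCoModule D × AllPairs Disjoint D

  IsMinimalCoModule : Subset n → Set
  IsMinimalCoModule M = IsCoModule M × (∀ N → IsCoModule N → N ⊆ M → N ≡ M)

  IsDeltaDecomposition : List (Subset n) → Set
  IsDeltaDecomposition D =
    IsCoModularDecomposition D
    × (∀ D' → IsCoModularDecomposition D' → length D' Data.Nat.≤ length D)
    × All IsMinimalCoModule D

  IsTransitiveOn : Subset n → Set
  IsTransitiveOn C = ∀ x y z → x ∈ C → y ∈ C → z ∈ C →
    arc T x y ≡ true → arc T y z ≡ true → arc T x z ≡ true

  IsTransitiveComponent : Subset n → Set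
  IsTransitiveComponent C =
    IsModule C × IsTransitiveOn C
    × (∀ C' → IsModule C' → IsTransitiveOn C' → C ⊆ C' → C' ≡ C)

  IsLabeling : {m : ℕ} → Subset n → (Fin m → Fin n) → Set
  IsLabeling C v = (∀ x → x ∈ C → ∃ λ i → v i ≡ x)
                 × (∀ i → v i ∈ C)
                 × (∀ i j → i < j → arc T (v i) (v j) ≡ true)

  -- "C(k) ∈ D": the element of mc(T) among {v_k,v_{k+1}}, {v_k}, {v_{k+1}} lies in D
  -- (the paper shows exactly one of them is in mc(T))
  PieceIn : Fin n → Fin n → List (Subset n) → Set
  PieceIn a b D = ∃ λ X → ((X ≡ ⁅ a ⁆ ∪ ⁅ b ⁆) ⊎ (X ≡ ⁅ a ⁆) ⊎ (X ≡ ⁅ b ⁆))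
                          × IsMinimalCoModule X × X LM.∈ D

module Submission where

-- Let C be a transitive component with at least four elements, labelled
-- v₀ → v₁ → … → v_{m-1}.  Its start piece C(0) is {v₀} if v₀ dominates the
-- whole tournament and {v₀,v₁} otherwise; its end piece C(m-2) is the start
-- piece of C in the opposite tournament.  We show:
--   * every piece is a minimal co-module;
--   * no two disjoint minimal co-modules can both meet a piece ("unsplittable"),
--     because a minimal co-module containing v₀ but not v₁ forces v₀ to be a source;
--   * two pieces are equal or disjoint (distinct components are disjoint, and
--     the two ends of a component with ≥ 4 elements do not overlap).
-- Consequently, inserting an unsplittable minimal co-module X into a
-- δ-decomposition D and deleting the (at most one) member of D meeting X again
-- yields a δ-decomposition.  Starting from any δ-decomposition (it exists: take a
-- longest co-modular decomposition and shrink each member to a minimal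
-- co-module) and inserting all pieces one after the other gives a
-- δ-decomposition containing every piece, which is the theorem.
--
-- Most facts about end pieces are obtained from those about start pieces by
-- passing to the opposite tournament.

open import Defs
open import Data.Nat as ℕ using (ℕ; zero; suc; _+_; _≤_; z≤n; s≤s)
import Data.Nat.Properties as ℕP
open import Data.Bool as Bool using (true; false; not)
open import Data.Bool.Properties using (not-involutive)
open import Data.Fin using (Fin; zero; suc; toℕ; fromℕ; inject₁; opposite)
open import Data.Fin.Properties using (all?; any?; toℕ<n; opposite-prop; opposite-involutive)
  renaming (_≟_ to _≟ᶠ_)
open import Data.Fin.Subset using (Subset; _∈_; _∉_; _⊆_; ∁; ⁅_⁆; _∪_; _∩_; ⊥; ⊤; ∣_∣)
open import Data.Fin.Subset.Properties
  using (_∈?_; _⊆?_; anySubset?; nonempty?; Empty-unique; ⊆-antisym; ∉⊥; ∈⊤; ⊆⊤; ∣p∣≤n;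
         ∣⊥∣≡0; ∣⁅x⁆∣≡1; x∈⁅x⁆; x∈⁅y⁆⇒x≡y; x≢y⇒x∉⁅y⁆; x∉⁅y⁆⇒x≢y; p⊂q⇒∣p∣<∣q∣;
         x∈p⇒x∉∁p; x∈∁p⇒x∉p; x∉∁p⇒x∈p; x∉p⇒x∈∁p; p⊆p∪q; q⊆p∪q; x∈p∪q⁺; x∈p∪q⁻;
         x∈p∩q⁺; x∈p∩q⁻; p∩q⊆p; ∪-comm)
import Data.Vec as Vec
open import Data.Vec.Properties using (≡-dec)
open import Data.List using (List; []; _∷_; length; filter; map; _++_)
open import Data.List.Properties using (filter-all)
open import Data.List.Relation.Unary.All as All using (All; []; _∷_)
import Data.List.Relation.Unary.All.Properties as AllP
open import Data.List.Relation.Unary.AllPairs using (AllPairs; []; _∷_)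
import Data.List.Relation.Unary.AllPairs.Properties as AllPairsP
open import Data.List.Relation.Unary.Any using (here; there)
open import Data.List.Relation.Binary.Pointwise using (Pointwise; []; _∷_)
open import Data.List.Relation.Binary.Pointwise.Properties using (Pointwise-length)
open import Data.List.Membership.Propositional using () renaming (_∈_ to _∈ₗ_)
open import Data.List.Membership.Propositional.Properties using (∈-filter⁺; ∈-map⁺; ∈-++⁺ˡ; ∈-++⁺ʳ)
open import Data.Product using (Σ; ∃; _×_; _,_; proj₁; proj₂)
open import Data.Sum using (_⊎_; inj₁; inj₂)
open import Data.Unit using (tt) renaming (⊤ to Unit)
open import Data.Empty using (⊥-elim) renaming (⊥ to False)
open import Relation.Nullary using (¬_; Dec; yes; no; contradiction)
open import Relation.Nullary.Decidable using (_×-dec_; _⊎-dec_; _→-dec_; ¬?; decidable-stable; map′)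
open import Function using (_∘_; _∘′_)
open import Relation.Binary.PropositionalEquality

module _ {n : ℕ} (T : Tournament n) where

  arc⇒≢ : ∀ {x y} → arc T x y ≡ true → x ≢ y
  arc⇒≢ {x} xy refl = contradiction (trans (sym xy) (irrefl T x)) λ ()

  arc-asym : ∀ {x y} → arc T x y ≡ true → arc T y x ≡ false
  arc-asym {x} {y} xy = trans (tourn T x y (arc⇒≢ xy)) (cong not xy)

  arc-antisym : ∀ {x y} → arc T x y ≡ true → ¬ arc T y x ≡ true
  arc-antisym xy yx = contradiction (trans (sym (arc-asym xy)) yx) λ ()

  arc-total : ∀ {x y} → x ≢ y → arc T x y ≡ false → arc T y x ≡ true
  arc-total {x} {y} x≢y xy = trans (tourn T x y x≢y) (cong not xy)

  Source : Fin n → Set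
  Source a = ∀ z → z ≢ a → arc T a z ≡ true

module _ {n : ℕ} where

  ∁-involutive : (p : Subset n) → ∁ (∁ p) ≡ p
  ∁-involutive p = ⊆-antisym (x∉∁p⇒x∈p ∘′ x∈∁p⇒x∉p) (x∉p⇒x∈∁p ∘′ x∈p⇒x∉∁p)

  singleton-unique : ∀ {N : Subset n} {a} → (∀ x → x ∈ N → x ≡ a) → a ∈ N → N ≡ ⁅ a ⁆
  singleton-unique only-a a∈N =
    ⊆-antisym (λ {x} x∈N → subst (_∈ ⁅ _ ⁆) (sym (only-a x x∈N)) (x∈⁅x⁆ _))
              (λ {x} x∈ → subst (_∈ _) (sym (x∈⁅y⁆⇒x≡y _ x∈)) a∈N)

  ∈-pair⁻ : ∀ {x a b : Fin n} → x ∈ ⁅ a ⁆ ∪ ⁅ b ⁆ → x ≡ a ⊎ x ≡ b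
  ∈-pair⁻ {a = a} {b} x∈ with x∈p∪q⁻ ⁅ a ⁆ ⁅ b ⁆ x∈
  ... | inj₁ x∈a = inj₁ (x∈⁅y⁆⇒x≡y a x∈a)
  ... | inj₂ x∈b = inj₂ (x∈⁅y⁆⇒x≡y b x∈b)

  ∈-pairˡ : ∀ {a b : Fin n} → a ∈ ⁅ a ⁆ ∪ ⁅ b ⁆
  ∈-pairˡ {a} = x∈p∪q⁺ (inj₁ (x∈⁅x⁆ a))

  ∈-pairʳ : ∀ {a b : Fin n} → b ∈ ⁅ a ⁆ ∪ ⁅ b ⁆
  ∈-pairʳ {b = b} = x∈p∪q⁺ (inj₂ (x∈⁅x⁆ b))

  card-one : ∀ {p : Subset n} → ∣ p ∣ ≡ 1 → ∃ λ r → r ∈ p × (∀ y → y ∈ p → y ≡ r)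
  card-one {p} ∣p∣≡1 with nonempty? p
  ... | no empty = contradiction (trans (sym (cong ∣_∣ (Empty-unique empty))) ∣p∣≡1)
                     (λ ∣⊥∣≡1 → contradiction (trans (sym (∣⊥∣≡0 n)) ∣⊥∣≡1) λ ())
  ... | yes (r , r∈p) = r , r∈p , only-r
    where
      only-r : ∀ y → y ∈ p → y ≡ r
      only-r y y∈p with y ≟ᶠ r
      ... | yes y≡r = y≡r
      ... | no y≢r = contradiction (trans (∣⁅x⁆∣≡1 r) (sym ∣p∣≡1))
                       (ℕP.<⇒≢ (p⊂q⇒∣p∣<∣q∣ (r⊆p , y , y∈p , x≢y⇒x∉⁅y⁆ y≢r)))
        where
          r⊆p : ⁅ r ⁆ ⊆ p
          r⊆p x∈ = subst (_∈ p) (sym (x∈⁅y⁆⇒x≡y r x∈)) r∈p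

  two-members : ∀ {p : Subset n} {a b} → a ∈ p → b ∈ p → a ≢ b → ∣ p ∣ ≢ 1
  two-members a∈ b∈ a≢b ∣p∣≡1 with card-one ∣p∣≡1
  ... | r , _ , only-r = a≢b (trans (only-r _ a∈) (sym (only-r _ b∈)))

  proper-subset-smaller : ∀ {N M : Subset n} → N ⊆ M → N ≢ M → ∣ N ∣ ℕ.< ∣ M ∣
  proper-subset-smaller {N} {M} N⊆M N≢M with any? (λ x → (x ∈? M) ×-dec ¬? (x ∈? N))
  ... | yes (x , x∈M , x∉N) = p⊂q⇒∣p∣<∣q∣ (N⊆M , x , x∈M , x∉N)
  ... | no M⊆N = contradiction (⊆-antisym N⊆M λ {x} x∈M →
                   decidable-stable (x ∈? N) λ x∉N → M⊆N (x , x∈M , x∉N)) N≢M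

  subsets-of-singleton : ∀ {N : Subset n} {a} → N ⊆ ⁅ a ⁆ → N ≡ ⊥ ⊎ N ≡ ⁅ a ⁆
  subsets-of-singleton {N} {a} N⊆a with a ∈? N
  ... | yes a∈N = inj₂ (singleton-unique (λ x x∈N → x∈⁅y⁆⇒x≡y a (N⊆a x∈N)) a∈N)
  ... | no a∉N = inj₁ (Empty-unique λ (x , x∈N) →
                   a∉N (subst (_∈ N) (x∈⁅y⁆⇒x≡y a (N⊆a x∈N)) x∈N))

  subsets-of-pair : ∀ {N : Subset n} {a b} → N ⊆ ⁅ a ⁆ ∪ ⁅ b ⁆ →
                    N ≡ ⊥ ⊎ N ≡ ⁅ a ⁆ ⊎ N ≡ ⁅ b ⁆ ⊎ N ≡ ⁅ a ⁆ ∪ ⁅ b ⁆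
  subsets-of-pair {N} {a} {b} N⊆ab with a ∈? N | b ∈? N
  ... | yes a∈N | yes b∈N = inj₂ (inj₂ (inj₂ (⊆-antisym N⊆ab ab⊆N)))
    where
      ab⊆N : ⁅ a ⁆ ∪ ⁅ b ⁆ ⊆ N
      ab⊆N x∈ with ∈-pair⁻ x∈
      ... | inj₁ refl = a∈N
      ... | inj₂ refl = b∈N
  ... | yes a∈N | no b∉N = inj₂ (inj₁ (singleton-unique only-a a∈N))
    where
      only-a : ∀ x → x ∈ N → x ≡ a
      only-a x x∈N with ∈-pair⁻ (N⊆ab x∈N)
      ... | inj₁ x≡a = x≡a
      ... | inj₂ refl = contradiction x∈N b∉N
  ... | no a∉N | yes b∈N = inj₂ (inj₂ (inj₁ (singleton-unique only-b b∈N)))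
    where
      only-b : ∀ x → x ∈ N → x ≡ b
      only-b x x∈N with ∈-pair⁻ (N⊆ab x∈N)
      ... | inj₁ refl = contradiction x∈N a∉N
      ... | inj₂ x≡b = x≡b
  ... | no a∉N | no b∉N = inj₁ (Empty-unique λ (x , x∈N) → neither x∈N (∈-pair⁻ (N⊆ab x∈N)))
    where
      neither : ∀ {x} → x ∈ N → ¬ (x ≡ a ⊎ x ≡ b)
      neither x∈N (inj₁ refl) = a∉N x∈N
      neither x∈N (inj₂ refl) = b∉N x∈N

  infix 4 _≟ˢ_
  _≟ˢ_ : (p q : Subset n) → Dec (p ≡ q)
  _≟ˢ_ = ≡-dec Bool._≟_

  allSubsets? : {P : Subset n → Set} → (∀ p → Dec (P p)) → Dec (∀ p → P p)
  allSubsets? P? with anySubset? (λ p → ¬? (P? p))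
  ... | yes (p , ¬Pp) = no (λ all-P → ¬Pp (all-P p))
  ... | no none = yes (λ p → decidable-stable (P? p) (λ ¬Pp → none (p , ¬Pp)))

allSubsets : ∀ n → List (Subset n)
allSubsets zero = Vec.[] ∷ []
allSubsets (suc n) = map (true Vec.∷_) (allSubsets n) ++ map (false Vec.∷_) (allSubsets n)

allSubsets-complete : ∀ {n} (p : Subset n) → p ∈ₗ allSubsets n
allSubsets-complete Vec.[] = here refl
allSubsets-complete (true Vec.∷ p) = ∈-++⁺ˡ (∈-map⁺ (true Vec.∷_) (allSubsets-complete p))
allSubsets-complete {suc n} (false Vec.∷ p) =
  ∈-++⁺ʳ (map (true Vec.∷_) (allSubsets n)) (∈-map⁺ (false Vec.∷_) (allSubsets-complete p))

-- Modules and co-modules.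
module _ {n : ℕ} (T : Tournament n) where

  module-via : ∀ {M : Subset n} (w : Fin n) →
               (∀ v x → v ∉ M → x ∈ M → arc T v x ≡ arc T v w) → IsModule T M
  module-via w sees-w x y v x∈ y∈ v∉ = trans (sees-w v x v∉ x∈) (sym (sees-w v y v∉ y∈))

  module-∪ : ∀ {M M' w} → IsModule T M → IsModule T M' → w ∈ M → w ∈ M' → IsModule T (M ∪ M')
  module-∪ {M} {M'} {w} modM modM' w∈M w∈M' = module-via w sees-w
    where
      sees-w : ∀ v x → v ∉ M ∪ M' → x ∈ M ∪ M' → arc T v x ≡ arc T v w
      sees-w v x v∉ x∈ with x∈p∪q⁻ M M' x∈
      ... | inj₁ x∈M = modM x w v x∈M w∈M (v∉ ∘ p⊆p∪q M')
      ... | inj₂ x∈M' = modM' x w v x∈M' w∈M' (v∉ ∘ q⊆p∪q M M')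

  nontrivial-by-members : ∀ {M : Subset n} {x y z} → x ∈ M → y ∈ M → x ≢ y → z ∉ M →
                          ¬ Trivial T M
  nontrivial-by-members x∈ _ _ _ (inj₁ M≡⊥) = ∉⊥ (subst (_ ∈_) M≡⊥ x∈)
  nontrivial-by-members x∈ y∈ x≢y _ (inj₂ (inj₁ ∣M∣≡1)) = two-members x∈ y∈ x≢y ∣M∣≡1
  nontrivial-by-members _ _ _ z∉ (inj₂ (inj₂ M≡⊤)) = z∉ (subst (_ ∈_) (sym M≡⊤) ∈⊤)

  singleton-trivial : ∀ a → Trivial T ⁅ a ⁆
  singleton-trivial a = inj₂ (inj₁ (∣⁅x⁆∣≡1 a))

  -- Co-modules are nonempty: ⊥ is trivial and its complement ⊤ is trivial too.
  comodule-nonempty : ∀ {M} → IsCoModule T M → ∃ λ x → x ∈ M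
  comodule-nonempty {M} coM with nonempty? M
  ... | yes nonempty = nonempty
  ... | no empty with coM
  ...   | inj₁ (_ , ntM) = contradiction (inj₁ (Empty-unique empty)) ntM
  ...   | inj₂ (_ , nt∁M) = contradiction (inj₂ (inj₂ ∁M≡⊤)) nt∁M
    where
      ∁M≡⊤ : ∁ M ≡ ⊤
      ∁M≡⊤ = ⊆-antisym ⊆⊤ (λ _ → x∉p⇒x∈∁p (λ x∈M → empty (_ , x∈M)))

  source⇒module : ∀ {a} → Source T a → IsModule T (∁ ⁅ a ⁆)
  source⇒module {a} src x y v x∈ y∈ v∉ with x∈⁅y⁆⇒x≡y a (x∉∁p⇒x∈p v∉)
  ... | refl = trans (src x (x∉⁅y⁆⇒x≢y (x∈∁p⇒x∉p x∈))) (sym (src y (x∉⁅y⁆⇒x≢y (x∈∁p⇒x∉p y∈))))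

  module⇒source : ∀ {a b} → IsModule T (∁ ⁅ a ⁆) → arc T a b ≡ true → Source T a
  module⇒source {a} {b} mod ab z z≢a =
    trans (mod z b a (x∉p⇒x∈∁p (x≢y⇒x∉⁅y⁆ z≢a)) (x∉p⇒x∈∁p (x≢y⇒x∉⁅y⁆ (≢-sym (arc⇒≢ T ab))))
              (x∈p⇒x∉∁p (x∈⁅x⁆ a)))
          ab

  -- If ⁅ a ⁆ is a co-module then, ⁅ a ⁆ being trivial, its complement is a module,
  -- so a is a source (as soon as it has an out-neighbour).
  singleton-comodule⇒source : ∀ {a b} → IsCoModule T ⁅ a ⁆ → arc T a b ≡ true → Source T a
  singleton-comodule⇒source {a} (inj₁ (_ , nt)) _ = contradiction (singleton-trivial a) nt
  singleton-comodule⇒source (inj₂ (mod , _)) ab = module⇒source mod ab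

  module? : ∀ M → Dec (IsModule T M)
  module? M = all? λ x → all? λ y → all? λ v →
    (x ∈? M) →-dec ((y ∈? M) →-dec (¬? (v ∈? M) →-dec (arc T v x Bool.≟ arc T v y)))

  trivial? : ∀ M → Dec (Trivial T M)
  trivial? M = (M ≟ˢ ⊥) ⊎-dec ((∣ M ∣ ℕ.≟ 1) ⊎-dec (M ≟ˢ ⊤))

  comodule? : ∀ M → Dec (IsCoModule T M)
  comodule? M = nontrivial-module? M ⊎-dec nontrivial-module? (∁ M)
    where
      nontrivial-module? : ∀ M → Dec (IsNontrivialModule T M)
      nontrivial-module? M = module? M ×-dec ¬? (trivial? M)

  disjoint? : ∀ X Y → Dec (Disjoint T X Y)
  disjoint? X Y = all? λ x → (x ∈? X) →-dec ((x ∈? Y) →-dec no (λ ()))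

  Meets : Subset n → Subset n → Set
  Meets A X = ∃ λ x → x ∈ A × x ∈ X

  meets? : ∀ A X → Dec (Meets A X)
  meets? A X = any? λ x → (x ∈? A) ×-dec (x ∈? X)

-- Transitive components.
module _ {n : ℕ} (T : Tournament n) where

  NoTriangleArc : Subset n → Set
  NoTriangleArc M = ∀ p q r → arc T p q ≡ true → arc T q r ≡ true → arc T r p ≡ true →
                    p ∈ M → ¬ q ∈ M

  -- A transitive module contains no arc of a triangle: the third vertex would
  -- lie inside (contradicting transitivity) or outside (contradicting modularity).
  transitive-module-no-triangle-arc : ∀ {M} → IsModule T M → IsTransitiveOn T M → NoTriangleArc M
  transitive-module-no-triangle-arc {M} modM transM p q r pq qr rp p∈ q∈ with r ∈? M
  ... | yes r∈ = arc-antisym T (transM p q r p∈ q∈ r∈ pq qr) rp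
  ... | no r∉ = contradiction (trans (sym rp) (trans (modM p q r p∈ q∈ r∉) (arc-asym T qr))) λ ()

  singleton-no-triangle-arc : ∀ r → NoTriangleArc ⁅ r ⁆
  singleton-no-triangle-arc r p q _ pq _ _ p∈ q∈ =
    arc⇒≢ T pq (trans (x∈⁅y⁆⇒x≡y r p∈) (sym (x∈⁅y⁆⇒x≡y r q∈)))

  -- If M and M' contain no triangle arc, then M ∪ M' is transitive: a triangle
  -- in M ∪ M' would have two of its three vertices in the same part.
  no-triangle-arc-∪ : ∀ {M M'} → NoTriangleArc M → NoTriangleArc M' → IsTransitiveOn T (M ∪ M')
  no-triangle-arc-∪ {M} {M'} noM noM' x y z x∈ y∈ z∈ xy yz with arc T x z in xz
  ... | true = refl
  ... | false = ⊥-elim (in-one-part (x∈p∪q⁻ M M' x∈) (x∈p∪q⁻ M M' y∈) (x∈p∪q⁻ M M' z∈))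
    where
      zx : arc T z x ≡ true
      zx = arc-total T (λ { refl → arc-antisym T xy yz }) xz
      in-one-part : x ∈ M ⊎ x ∈ M' → y ∈ M ⊎ y ∈ M' → z ∈ M ⊎ z ∈ M' → False
      in-one-part (inj₁ x∈M) (inj₁ y∈M) _ = contradiction y∈M (noM x y z xy yz zx x∈M)
      in-one-part (inj₂ x∈M) (inj₂ y∈M) _ = contradiction y∈M (noM' x y z xy yz zx x∈M)
      in-one-part _ (inj₁ y∈M) (inj₁ z∈M) = contradiction z∈M (noM y z x yz zx xy y∈M)
      in-one-part _ (inj₂ y∈M) (inj₂ z∈M) = contradiction z∈M (noM' y z x yz zx xy y∈M)
      in-one-part (inj₁ x∈M) _ (inj₁ z∈M) = contradiction x∈M (noM z x y zx xy yz z∈M)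
      in-one-part (inj₂ x∈M) _ (inj₂ z∈M) = contradiction x∈M (noM' z x y zx xy yz z∈M)

  component-not-extendable : ∀ {C r} → IsTransitiveComponent T C → r ∉ C → ¬ IsModule T (C ∪ ⁅ r ⁆)
  component-not-extendable {C} {r} (modC , transC , maxC) r∉C modCr =
    r∉C (subst (r ∈_) C∪r≡C (q⊆p∪q C ⁅ r ⁆ (x∈⁅x⁆ r)))
    where
      C∪r≡C : C ∪ ⁅ r ⁆ ≡ C
      C∪r≡C = maxC (C ∪ ⁅ r ⁆) modCr
                (no-triangle-arc-∪ (transitive-module-no-triangle-arc modC transC)
                                   (singleton-no-triangle-arc r))
                (p⊆p∪q ⁅ r ⁆)

  -- Two transitive components with a common vertex coincide, since their
  -- union is again a transitive module.
  components-meet⇒equal : ∀ {C C' w} → IsTransitiveComponent T C → IsTransitiveComponent T C' →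
                          w ∈ C → w ∈ C' → C ≡ C'
  components-meet⇒equal {C} {C'} (modC , transC , maxC) (modC' , transC' , maxC') w∈C w∈C' =
    trans (sym (maxC (C ∪ C') mod∪ trans∪ (p⊆p∪q C'))) (maxC' (C ∪ C') mod∪ trans∪ (q⊆p∪q C C'))
    where
      mod∪ : IsModule T (C ∪ C')
      mod∪ = module-∪ T modC modC' w∈C w∈C'
      trans∪ : IsTransitiveOn T (C ∪ C')
      trans∪ = no-triangle-arc-∪ (transitive-module-no-triangle-arc modC transC)
                                 (transitive-module-no-triangle-arc modC' transC')

  transitive? : ∀ C → Dec (IsTransitiveOn T C)
  transitive? C = all? λ x → all? λ y → all? λ z →
    (x ∈? C) →-dec ((y ∈? C) →-dec ((z ∈? C) →-dec
      ((arc T x y Bool.≟ true) →-dec ((arc T y z Bool.≟ true) →-dec (arc T x z Bool.≟ true)))))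

  component? : ∀ C → Dec (IsTransitiveComponent T C)
  component? C = module? T C ×-dec (transitive? C ×-dec allSubsets? λ C' →
    module? T C' →-dec (transitive? C' →-dec ((C ⊆? C') →-dec (C' ≟ˢ C))))

-- Its modules,
-- co-modules, transitive components and labelings (read backwards) are those of T;
-- reversing twice gives back the arcs of T definitionally.
op : ∀ {n} → Tournament n → Tournament n
op T = record
  { arc = λ x y → arc T y x
  ; irrefl = irrefl T
  ; tourn = λ x y x≢y → trans (sym (not-involutive _)) (cong not (sym (tourn T x y x≢y)))
  }

module _ {n : ℕ} (T : Tournament n) where

  op-module : ∀ {M} → IsModule T M → IsModule (op T) M
  op-module {M} modM x y v x∈ y∈ v∉ = begin
    arc T x v        ≡⟨ tourn T v x (λ { refl → v∉ x∈ }) ⟩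
    not (arc T v x)  ≡⟨ cong not (modM x y v x∈ y∈ v∉) ⟩
    not (arc T v y)  ≡⟨ tourn T v y (λ { refl → v∉ y∈ }) ⟨
    arc T y v        ∎
    where open ≡-Reasoning

  op-comodule : ∀ {M} → IsCoModule T M → IsCoModule (op T) M
  op-comodule (inj₁ (modM , ntM)) = inj₁ (op-module modM , ntM)
  op-comodule (inj₂ (mod∁M , nt∁M)) = inj₂ (op-module mod∁M , nt∁M)

  op-transitive : ∀ {C} → IsTransitiveOn T C → IsTransitiveOn (op T) C
  op-transitive transC x y z x∈ y∈ z∈ yx zy = transC z y x z∈ y∈ x∈ zy yx

module _ {n : ℕ} (T : Tournament n) where

  op-minimal : ∀ {M} → IsMinimalCoModule T M → IsMinimalCoModule (op T) M
  op-minimal (coM , minM) = op-comodule T coM , λ N coN N⊆M → minM N (op-comodule (op T) coN) N⊆M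

  op-component : ∀ {C} → IsTransitiveComponent T C → IsTransitiveComponent (op T) C
  op-component (modC , transC , maxC) =
    op-module T modC , op-transitive T transC ,
    λ C' modC' transC' C⊆C' → maxC C' (op-module (op T) modC') (op-transitive (op T) transC') C⊆C'

  op-labeling : ∀ {C k} {v : Fin k → Fin n} → IsLabeling T C v → IsLabeling (op T) C (v ∘ opposite)
  op-labeling {v = v} (onto , v∈C , v-increasing) =
    (λ x x∈C → let (i , vi≡x) = onto x x∈C in opposite i , trans (cong v (opposite-involutive i)) vi≡x) ,
    v∈C ∘ opposite ,
    λ i j i<j → v-increasing (opposite j) (opposite i) (opposite-reverses-< i<j)
    where
      opposite-reverses-< : ∀ {k} {i j : Fin k} → toℕ i ℕ.< toℕ j → toℕ (opposite j) ℕ.< toℕ (opposite i)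
      opposite-reverses-< {k} {i} {j} i<j =
        subst₂ ℕ._<_ (sym (opposite-prop j)) (sym (opposite-prop i)) (ℕP.∸-monoʳ-< (s≤s i<j) (toℕ<n j))

module _ {n : ℕ} (T : Tournament n) where

  record Head (C : Subset n) (a b c : Fin n) : Set where
    constructor mkHead
    field
      component : IsTransitiveComponent T C
      a∈C : a ∈ C
      b∈C : b ∈ C
      c∈C : c ∈ C
      a≢b : a ≢ b
      a≢c : a ≢ c
      b≢c : b ≢ c
      a-first : ∀ z → z ∈ C → z ≢ a → arc T a z ≡ true
      b-second : ∀ z → z ∈ C → z ≢ a → z ≢ b → arc T b z ≡ true

  StartPiece : Fin n → Fin n → Subset n → Set
  StartPiece a b X = (Source T a × X ≡ ⁅ a ⁆) ⊎ (¬ Source T a × X ≡ ⁅ a ⁆ ∪ ⁅ b ⁆)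

  Unsplittable : Subset n → Set
  Unsplittable X = ∀ A B → IsMinimalCoModule T A → IsMinimalCoModule T B → Disjoint T A B →
                   Meets T A X → ¬ Meets T B X

  source? : ∀ a → Dec (Source T a)
  source? a = all? λ z → ¬? (z ≟ᶠ a) →-dec (arc T a z Bool.≟ true)

  startPiece? : ∀ a b X → Dec (StartPiece a b X)
  startPiece? a b X = (source? a ×-dec (X ≟ˢ ⁅ a ⁆)) ⊎-dec (¬? (source? a) ×-dec (X ≟ˢ ⁅ a ⁆ ∪ ⁅ b ⁆))

  head? : ∀ C a b c → Dec (Head C a b c)
  head? C a b c = map′ (λ (t , a∈ , b∈ , c∈ , a≢b , a≢c , b≢c , fst , snd) →
                          mkHead t a∈ b∈ c∈ a≢b a≢c b≢c fst snd)
                       (λ h → let open Head h in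
                          component , a∈C , b∈C , c∈C , a≢b , a≢c , b≢c , a-first , b-second)
    (component? T C ×-dec (a ∈? C) ×-dec (b ∈? C) ×-dec (c ∈? C) ×-dec
     ¬? (a ≟ᶠ b) ×-dec ¬? (a ≟ᶠ c) ×-dec ¬? (b ≟ᶠ c) ×-dec
     (all? λ z → (z ∈? C) →-dec (¬? (z ≟ᶠ a) →-dec (arc T a z Bool.≟ true))) ×-dec
     (all? λ z → (z ∈? C) →-dec (¬? (z ≟ᶠ a) →-dec (¬? (z ≟ᶠ b) →-dec (arc T b z Bool.≟ true)))))

  startPiece-exists : ∀ a b → ∃ λ X → StartPiece a b X
  startPiece-exists a b with source? a
  ... | yes src = ⁅ a ⁆ , inj₁ (src , refl)
  ... | no ¬src = ⁅ a ⁆ ∪ ⁅ b ⁆ , inj₂ (¬src , refl)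

  startPiece-unique : ∀ {a b X Y} → StartPiece a b X → StartPiece a b Y → X ≡ Y
  startPiece-unique (inj₁ (_ , refl)) (inj₁ (_ , refl)) = refl
  startPiece-unique (inj₂ (_ , refl)) (inj₂ (_ , refl)) = refl
  startPiece-unique (inj₁ (src , _)) (inj₂ (¬src , _)) = contradiction src ¬src
  startPiece-unique (inj₂ (¬src , _)) (inj₁ (src , _)) = contradiction src ¬src

  startPiece-⊆ : ∀ {a b X x} → StartPiece a b X → x ∈ X → x ≡ a ⊎ x ≡ b
  startPiece-⊆ (inj₁ (_ , refl)) x∈ = inj₁ (x∈⁅y⁆⇒x≡y _ x∈)
  startPiece-⊆ (inj₂ (_ , refl)) x∈ = ∈-pair⁻ x∈

  module _ {C a b c} (h : Head C a b c) where
    open Head h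

    -- If a is a source, ⁅ a ⁆ is a minimal co-module: its complement is a
    -- module containing b and c.
    source-singleton-minimal : Source T a → IsMinimalCoModule T ⁅ a ⁆
    source-singleton-minimal src =
      inj₂ (source⇒module T src , nontrivial-by-members T (∉a b≢a) (∉a c≢a) b≢c (x∈p⇒x∉∁p (x∈⁅x⁆ a))) ,
      minimal
      where
        ∉a : ∀ {x} → x ≢ a → x ∈ ∁ ⁅ a ⁆
        ∉a x≢a = x∉p⇒x∈∁p (x≢y⇒x∉⁅y⁆ x≢a)
        b≢a : b ≢ a
        b≢a = ≢-sym a≢b
        c≢a : c ≢ a
        c≢a = ≢-sym a≢c
        minimal : ∀ N → IsCoModule T N → N ⊆ ⁅ a ⁆ → N ≡ ⁅ a ⁆
        minimal N coN N⊆a with subsets-of-singleton N⊆a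
        ... | inj₁ refl = ⊥-elim (∉⊥ (proj₂ (comodule-nonempty T coN)))
        ... | inj₂ N≡a = N≡a

    -- ⁅ a ⁆ ∪ ⁅ b ⁆ is a module: vertices outside C see a and b alike since C is
    -- a module, and the other vertices of C are beaten by both a and b.
    head-pair-module : IsModule T (⁅ a ⁆ ∪ ⁅ b ⁆)
    head-pair-module = module-via T a sees-a
      where
        sees-a : ∀ v x → v ∉ ⁅ a ⁆ ∪ ⁅ b ⁆ → x ∈ ⁅ a ⁆ ∪ ⁅ b ⁆ → arc T v x ≡ arc T v a
        sees-a v x v∉ x∈ with ∈-pair⁻ x∈ | v ∈? C
        ... | inj₁ refl | _ = refl
        ... | inj₂ refl | no v∉C = proj₁ component b a v b∈C a∈C v∉C
        ... | inj₂ refl | yes v∈C =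
          trans (arc-asym T (b-second v v∈C v≢a v≢b)) (sym (arc-asym T (a-first v v∈C v≢a)))
          where
            v≢a : v ≢ a
            v≢a refl = v∉ ∈-pairˡ
            v≢b : v ≢ b
            v≢b refl = v∉ ∈-pairʳ

    -- If a is not a source, ⁅ a ⁆ ∪ ⁅ b ⁆ is a minimal co-module: a co-module
    -- ⁅ a ⁆ or ⁅ b ⁆ would make a resp. b a source, but b does not beat a.
    head-pair-minimal : ¬ Source T a → IsMinimalCoModule T (⁅ a ⁆ ∪ ⁅ b ⁆)
    head-pair-minimal ¬src =
      inj₁ (head-pair-module , nontrivial-by-members T ∈-pairˡ ∈-pairʳ a≢b c∉) , minimal
      where
        c∉ : c ∉ ⁅ a ⁆ ∪ ⁅ b ⁆
        c∉ c∈ with ∈-pair⁻ c∈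
        ... | inj₁ refl = a≢c refl
        ... | inj₂ refl = b≢c refl
        ab : arc T a b ≡ true
        ab = a-first b b∈C (≢-sym a≢b)
        bc : arc T b c ≡ true
        bc = b-second c c∈C (≢-sym a≢c) (≢-sym b≢c)
        minimal : ∀ N → IsCoModule T N → N ⊆ ⁅ a ⁆ ∪ ⁅ b ⁆ → N ≡ ⁅ a ⁆ ∪ ⁅ b ⁆
        minimal N coN N⊆ab with subsets-of-pair N⊆ab
        ... | inj₁ refl = ⊥-elim (∉⊥ (proj₂ (comodule-nonempty T coN)))
        ... | inj₂ (inj₁ refl) = contradiction (singleton-comodule⇒source T coN ab) ¬src
        ... | inj₂ (inj₂ (inj₁ refl)) =
          ⊥-elim (arc-antisym T ab (singleton-comodule⇒source T coN bc a a≢b))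
        ... | inj₂ (inj₂ (inj₂ N≡ab)) = N≡ab

    startPiece-minimal : ∀ {X} → StartPiece a b X → IsMinimalCoModule T X
    startPiece-minimal (inj₁ (src , refl)) = source-singleton-minimal src
    startPiece-minimal (inj₂ (¬src , refl)) = head-pair-minimal ¬src

  -- Let A be a minimal co-module which is a nontrivial module containing a but
  -- not b.  Every vertex of A ∖ C beats all of C, so A ∖ C is a module not
  -- containing a; minimality of A leaves only A ∖ C = ∅ (then A = ⁅ a ⁆ is
  -- trivial) or A ∖ C = ⁅ r ⁆ (then C ∪ ⁅ r ⁆ is a module, contradicting the
  -- maximality of C).
  module ModuleThroughHead {C a b c A} (h : Head C a b c) (minA : IsMinimalCoModule T A)
                           (modA : IsModule T A) (ntA : ¬ Trivial T A) (a∈A : a ∈ A) (b∉A : b ∉ A) where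
    open Head h

    modC : IsModule T C
    modC = proj₁ component

    ab : arc T a b ≡ true
    ab = a-first b b∈C (≢-sym a≢b)

    -- b sees every vertex of A as it sees a, which it does not beat.
    b-sees-A : ∀ y → y ∈ A → arc T b y ≡ false
    b-sees-A y y∈A = trans (modA y a b y∈A a∈A b∉A) (arc-asym T ab)

    only-a-in-C : ∀ y → y ∈ A → y ∈ C → y ≡ a
    only-a-in-C y y∈A y∈C with y ≟ᶠ a
    ... | yes y≡a = y≡a
    ... | no y≢a = contradiction (trans (sym by) (b-sees-A y y∈A)) λ ()
      where
        by : arc T b y ≡ true
        by = b-second y y∈C y≢a (λ { refl → b∉A y∈A })

    R : Subset n
    R = A ∩ ∁ C

    ∈R⁻ : ∀ {x} → x ∈ R → x ∈ A × x ∉ C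
    ∈R⁻ x∈R = let (x∈A , x∈∁C) = x∈p∩q⁻ A (∁ C) x∈R in x∈A , x∈∁p⇒x∉p x∈∁C

    outside-beats-C : ∀ r z → r ∈ A → r ∉ C → z ∈ C → arc T r z ≡ true
    outside-beats-C r z r∈A r∉C z∈C =
      trans (sym (modC b z r b∈C z∈C r∉C)) (arc-total T (λ { refl → b∉A r∈A }) (b-sees-A r r∈A))

    R-module : IsModule T R
    R-module x y w x∈R y∈R w∉R with w ∈? A | w ∈? C
    ... | no w∉A | _ = modA x y w (proj₁ (∈R⁻ x∈R)) (proj₁ (∈R⁻ y∈R)) w∉A
    ... | yes w∈A | no w∉C = contradiction (x∈p∩q⁺ (w∈A , x∉p⇒x∈∁p w∉C)) w∉R
    ... | yes _ | yes w∈C = trans (beaten-by x∈R) (sym (beaten-by y∈R))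
      where
        beaten-by : ∀ {x} → x ∈ R → arc T w x ≡ false
        beaten-by x∈R = arc-asym T (outside-beats-C _ w (proj₁ (∈R⁻ x∈R)) (proj₂ (∈R⁻ x∈R)) w∈C)

    a∉R : a ∉ R
    a∉R a∈R = proj₂ (∈R⁻ a∈R) a∈C

    -- If A ∖ C = ⁅ r ⁆ then C ∪ ⁅ r ⁆ is a module: a vertex outside it lies
    -- outside A, hence sees r as it sees a.
    single-outsider-module : ∀ {r} → r ∈ R → (∀ y → y ∈ R → y ≡ r) → IsModule T (C ∪ ⁅ r ⁆)
    single-outsider-module {r} r∈R only-r = module-via T a sees-a
      where
        sees-a : ∀ v x → v ∉ C ∪ ⁅ r ⁆ → x ∈ C ∪ ⁅ r ⁆ → arc T v x ≡ arc T v a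
        sees-a v x v∉ x∈ with x∈p∪q⁻ C ⁅ r ⁆ x∈
        ... | inj₁ x∈C = modC x a v x∈C a∈C (v∉ ∘ p⊆p∪q ⁅ r ⁆)
        ... | inj₂ x∈r = modA x a v x∈A a∈A v∉A
          where
            x∈A : x ∈ A
            x∈A = subst (_∈ A) (sym (x∈⁅y⁆⇒x≡y r x∈r)) (proj₁ (∈R⁻ r∈R))
            v∉A : v ∉ A
            v∉A v∈A with v ∈? C
            ... | yes v∈C = v∉ (p⊆p∪q ⁅ r ⁆ v∈C)
            ... | no v∉C = v∉ (q⊆p∪q C ⁅ r ⁆ (subst (_∈ ⁅ r ⁆) (sym v≡r) (x∈⁅x⁆ r)))
              where
                v≡r : v ≡ r
                v≡r = only-r v (x∈p∩q⁺ (v∈A , x∉p⇒x∈∁p v∉C))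

    impossible : False
    impossible with trivial? T R
    ... | no ntR = a∉R (subst (a ∈_) (sym (proj₂ minA R (inj₁ (R-module , ntR)) (p∩q⊆p A (∁ C)))) a∈A)
    ... | yes (inj₁ R≡⊥) = ntA (subst (Trivial T) (sym A≡a) (singleton-trivial T a))
      where
        A≡a : A ≡ ⁅ a ⁆
        A≡a = singleton-unique (λ x x∈A → only-a-in-C x x∈A (decidable-stable (x ∈? C)
                (λ x∉C → ∉⊥ (subst (x ∈_) R≡⊥ (x∈p∩q⁺ (x∈A , x∉p⇒x∈∁p x∉C)))))) a∈A
    ... | yes (inj₂ (inj₁ ∣R∣≡1)) = let (r , r∈R , only-r) = card-one ∣R∣≡1 in
      component-not-extendable T component (proj₂ (∈R⁻ r∈R)) (single-outsider-module r∈R only-r)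
    ... | yes (inj₂ (inj₂ R≡⊤)) = a∉R (subst (a ∈_) (sym R≡⊤) ∈⊤)

  -- Let A be a minimal co-module whose complement is a module, with a ∈ A and
  -- b ∉ A.  Then U = ∁ A ∪ C is a module (both contain b).  If U covers all
  -- vertices, a beats everything; otherwise ∁ U is a co-module inside A
  -- missing a, contradicting the minimality of A.
  module ComplementThroughHead {C a b c A} (h : Head C a b c) (¬src : ¬ Source T a)
                               (minA : IsMinimalCoModule T A) (mod∁A : IsModule T (∁ A))
                               (a∈A : a ∈ A) (b∉A : b ∉ A) where
    open Head h

    b∈∁A : b ∈ ∁ A
    b∈∁A = x∉p⇒x∈∁p b∉A

    U : Subset n
    U = ∁ A ∪ C

    modU : IsModule T U
    modU = module-∪ T mod∁A (proj₁ component) b∈∁A b∈C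

    covering-impossible : (∀ z → z ∈ U) → False
    covering-impossible z∈U = ¬src src
      where
        src : Source T a
        src z z≢a with x∈p∪q⁻ (∁ A) C (z∈U z)
        ... | inj₁ z∈∁A = trans (mod∁A z b a z∈∁A b∈∁A (x∈p⇒x∉∁p a∈A)) (a-first b b∈C (≢-sym a≢b))
        ... | inj₂ z∈C = a-first z z∈C z≢a

    missing-impossible : ∀ {z} → z ∉ U → False
    missing-impossible z∉U = a∉∁U (subst (a ∈_) (sym ∁U≡A) a∈A)
      where
        ntU : ¬ Trivial T U
        ntU = nontrivial-by-members T (q⊆p∪q (∁ A) C a∈C) (q⊆p∪q (∁ A) C b∈C) a≢b z∉U
        ∁U≡A : ∁ U ≡ A
        ∁U≡A = proj₂ minA (∁ U) (inj₂ (subst (IsNontrivialModule T) (sym (∁-involutive U)) (modU , ntU)))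
                      (λ x∈∁U → x∉∁p⇒x∈p λ x∈∁A → x∈∁p⇒x∉p x∈∁U (p⊆p∪q C x∈∁A))
        a∉∁U : a ∉ ∁ U
        a∉∁U a∈∁U = x∈∁p⇒x∉p a∈∁U (q⊆p∪q (∁ A) C a∈C)

    impossible : False
    impossible with nonempty? (∁ U)
    ... | yes (z , z∈∁U) = missing-impossible (x∈∁p⇒x∉p z∈∁U)
    ... | no ∁U-empty = covering-impossible λ z → x∉∁p⇒x∈p λ z∈∁U → ∁U-empty (z , z∈∁U)

  module _ {C a b c} (h : Head C a b c) where
    open Head h

    minimal-through-head : ∀ {A} → ¬ Source T a → IsMinimalCoModule T A → a ∈ A → b ∈ A
    minimal-through-head {A} ¬src minA a∈A = decidable-stable (b ∈? A) b∉A-impossible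
      where
        b∉A-impossible : ¬ b ∉ A
        b∉A-impossible b∉A with proj₁ minA
        ... | inj₁ (modA , ntA) = ModuleThroughHead.impossible h minA modA ntA a∈A b∉A
        ... | inj₂ (mod∁A , _) = ComplementThroughHead.impossible h ¬src minA mod∁A a∈A b∉A

    -- The start piece is unsplittable: for ⁅ a ⁆ this is clear, and two disjoint
    -- minimal co-modules meeting ⁅ a ⁆ ∪ ⁅ b ⁆ in a resp. b are excluded above.
    startPiece-unsplittable : ∀ {X} → StartPiece a b X → Unsplittable X
    startPiece-unsplittable (inj₁ (_ , refl)) A B _ _ A∩B=∅ (x , x∈A , x∈a) (y , y∈B , y∈a)
      rewrite x∈⁅y⁆⇒x≡y a x∈a | x∈⁅y⁆⇒x≡y a y∈a = A∩B=∅ a x∈A y∈B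
    startPiece-unsplittable (inj₂ (¬src , refl)) A B minA minB A∩B=∅ (x , x∈A , x∈ab) (y , y∈B , y∈ab)
      with ∈-pair⁻ x∈ab | ∈-pair⁻ y∈ab
    ... | inj₁ refl | inj₁ refl = A∩B=∅ x x∈A y∈B
    ... | inj₂ refl | inj₂ refl = A∩B=∅ x x∈A y∈B
    ... | inj₁ refl | inj₂ refl = A∩B=∅ y (minimal-through-head ¬src minA x∈A) y∈B
    ... | inj₂ refl | inj₁ refl = A∩B=∅ x x∈A (minimal-through-head ¬src minB y∈B)

  head-first-unique : ∀ {C a b c a' b' c'} → Head C a b c → Head C a' b' c' → a ≡ a'
  head-first-unique {a = a} {a' = a'} h h' with a ≟ᶠ a'
  ... | yes a≡a' = a≡a'
  ... | no a≢a' = ⊥-elim (arc-antisym T (Head.a-first h a' (Head.a∈C h') (≢-sym a≢a'))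
                                        (Head.a-first h' a (Head.a∈C h) a≢a'))

  head-second-unique : ∀ {C a b c b' c'} → Head C a b c → Head C a b' c' → b ≡ b'
  head-second-unique {b = b} {b' = b'} h h' with b ≟ᶠ b'
  ... | yes b≡b' = b≡b'
  ... | no b≢b' =
    ⊥-elim (arc-antisym T (Head.b-second h b' (Head.b∈C h') (≢-sym (Head.a≢b h')) (≢-sym b≢b'))
                          (Head.b-second h' b (Head.b∈C h) (≢-sym (Head.a≢b h)) b≢b'))

  labeling-head : ∀ {C k c} {v : Fin (suc (suc k)) → Fin n} → IsTransitiveComponent T C →
                  IsLabeling T C v → c ∈ C → v zero ≢ c → v (suc zero) ≢ c →
                  Head C (v zero) (v (suc zero)) c
  labeling-head {C} {v = v} compC (onto , v∈C , v-increasing) c∈C v₀≢c v₁≢c =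
    mkHead compC (v∈C zero) (v∈C (suc zero)) c∈C (arc⇒≢ T (v-increasing zero (suc zero) (s≤s z≤n)))
           v₀≢c v₁≢c first second
    where
      first : ∀ z → z ∈ C → z ≢ v zero → arc T (v zero) z ≡ true
      first z z∈C z≢v₀ with onto z z∈C
      ... | zero , refl = contradiction refl z≢v₀
      ... | suc i , refl = v-increasing zero (suc i) (s≤s z≤n)
      second : ∀ z → z ∈ C → z ≢ v zero → z ≢ v (suc zero) → arc T (v (suc zero)) z ≡ true
      second z z∈C z≢v₀ z≢v₁ with onto z z∈C
      ... | zero , refl = contradiction refl z≢v₀
      ... | suc zero , refl = contradiction refl z≢v₁
      ... | suc (suc i) , refl = v-increasing (suc zero) (suc (suc i)) (s≤s (s≤s z≤n))

-- Pieces: the start and end pieces of transitive components with at least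
-- four vertices.  The end piece of C is its start piece in the opposite tournament.
module _ {n : ℕ} (T : Tournament n) where

  record Ends (C : Subset n) (a b c d : Fin n) : Set where
    constructor mkEnds
    field
      head : Head T C a b c
      tail : Head (op T) C d c b
      a≢d : a ≢ d

  EndPieces : Fin n → Fin n → Fin n → Fin n → Subset n → Set
  EndPieces a b c d X = StartPiece T a b X ⊎ StartPiece (op T) d c X

  Piece : Subset n → Set
  Piece X = Σ (Subset n) λ C → Σ (Fin n) λ a → Σ (Fin n) λ b → Σ (Fin n) λ c → Σ (Fin n) λ d →
            Ends C a b c d × EndPieces a b c d X

  piece? : ∀ X → Dec (Piece X)
  piece? X = anySubset? λ C → any? λ a → any? λ b → any? λ c → any? λ d →
    ends? C a b c d ×-dec (startPiece? T a b X ⊎-dec startPiece? (op T) d c X)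
    where
      ends? : ∀ C a b c d → Dec (Ends C a b c d)
      ends? C a b c d = map′ (λ (h , t , a≢d) → mkEnds h t a≢d)
                             (λ e → Ends.head e , Ends.tail e , Ends.a≢d e)
                             (head? T C a b c ×-dec head? (op T) C d c b ×-dec ¬? (a ≟ᶠ d))

  piece-minimal : ∀ {X} → Piece X → IsMinimalCoModule T X
  piece-minimal (_ , _ , _ , _ , _ , e , inj₁ start) = startPiece-minimal T (Ends.head e) start
  piece-minimal (_ , _ , _ , _ , _ , e , inj₂ end) =
    op-minimal (op T) (startPiece-minimal (op T) (Ends.tail e) end)

  piece-unsplittable : ∀ {X} → Piece X → Unsplittable T X
  piece-unsplittable (_ , _ , _ , _ , _ , e , inj₁ start) =
    startPiece-unsplittable T (Ends.head e) start
  piece-unsplittable (_ , _ , _ , _ , _ , e , inj₂ end) A B minA minB =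
    startPiece-unsplittable (op T) (Ends.tail e) end A B (op-minimal T minA) (op-minimal T minB)

  piece-⊆ : ∀ {X} → (p : Piece X) → X ⊆ proj₁ p
  piece-⊆ (_ , _ , _ , _ , _ , e , inj₁ start) x∈ with startPiece-⊆ T start x∈
  ... | inj₁ refl = Head.a∈C (Ends.head e)
  ... | inj₂ refl = Head.b∈C (Ends.head e)
  piece-⊆ (_ , _ , _ , _ , _ , e , inj₂ end) x∈ with startPiece-⊆ (op T) end x∈
  ... | inj₁ refl = Head.a∈C (Ends.tail e)
  ... | inj₂ refl = Head.b∈C (Ends.tail e)

  ends-unique : ∀ {C a b c d a' b' c' d'} → Ends C a b c d → Ends C a' b' c' d' →
                a ≡ a' × b ≡ b' × c ≡ c' × d ≡ d'
  ends-unique e e' with head-first-unique T (Ends.head e) (Ends.head e')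
                      | head-first-unique (op T) (Ends.tail e) (Ends.tail e')
  ... | refl | refl = refl , head-second-unique T (Ends.head e) (Ends.head e') ,
                      head-second-unique (op T) (Ends.tail e) (Ends.tail e') , refl

  start-end-disjoint : ∀ {C a b c d X Y} → Ends C a b c d →
                       StartPiece T a b X → StartPiece (op T) d c Y → Disjoint T X Y
  start-end-disjoint e start end x x∈X x∈Y with startPiece-⊆ T start x∈X | startPiece-⊆ (op T) end x∈Y
  ... | inj₁ refl | inj₁ x≡d = Ends.a≢d e x≡d
  ... | inj₁ refl | inj₂ x≡c = Head.a≢c (Ends.head e) x≡c
  ... | inj₂ refl | inj₁ x≡d = Head.a≢c (Ends.tail e) (sym x≡d)
  ... | inj₂ refl | inj₂ x≡c = Head.b≢c (Ends.head e) x≡c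

  -- Two pieces are equal or disjoint: pieces of different components lie in
  -- disjoint components, and a component has just one start and one end piece.
  pieces-equal-or-disjoint : ∀ {X Y} → Piece X → Piece Y → X ≡ Y ⊎ Disjoint T X Y
  pieces-equal-or-disjoint pX@(C , a , b , c , d , e , pieceX) pY@(C' , _ , _ , _ , _ , e' , pieceY)
    with meets? T C C'
  ... | no C∩C'≡∅ = inj₂ λ x x∈X x∈Y → C∩C'≡∅ (x , piece-⊆ pX x∈X , piece-⊆ pY x∈Y)
  ... | yes (w , w∈C , w∈C')
    with components-meet⇒equal T (Head.component (Ends.head e)) (Head.component (Ends.head e')) w∈C w∈C'
  ... | refl with ends-unique e e'
  ... | refl , refl , refl , refl = same-ends pieceX pieceY
    where
      same-ends : ∀ {X Y} → EndPieces a b c d X → EndPieces a b c d Y → X ≡ Y ⊎ Disjoint T X Y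
      same-ends (inj₁ startX) (inj₁ startY) = inj₁ (startPiece-unique T startX startY)
      same-ends (inj₂ endX) (inj₂ endY) = inj₁ (startPiece-unique (op T) endX endY)
      same-ends (inj₁ startX) (inj₂ endY) = inj₂ (start-end-disjoint e startX endY)
      same-ends (inj₂ endX) (inj₁ startY) = inj₂ λ x x∈X x∈Y → start-end-disjoint e startY endX x x∈Y x∈X

-- The exchange argument: an unsplittable minimal co-module can be inserted
-- into any δ-decomposition.
module _ {n : ℕ} (T : Tournament n) where

  avoiding : Subset n → List (Subset n) → List (Subset n)
  avoiding X = filter λ M → ¬? (meets? T M X)

  length-avoiding : ∀ {X} → Unsplittable T X → ∀ D → AllPairs (Disjoint T) D →
                    All (IsMinimalCoModule T) D → length D ≤ suc (length (avoiding X D))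
  length-avoiding unspl [] _ _ = z≤n
  length-avoiding {X} unspl (M ∷ D) (M∩D≡∅ ∷ disjD) (minM ∷ minD) with meets? T M X
  ... | no _ = s≤s (length-avoiding unspl D disjD minD)
  ... | yes M∩X = ℕP.≤-reflexive (cong (suc ∘ length) (sym (filter-all _ rest-avoids)))
    where
      rest-avoids : All (λ B → ¬ Meets T B X) D
      rest-avoids = All.zipWith (λ (M∩B≡∅ , minB) → unspl M _ minM minB M∩B≡∅ M∩X) (M∩D≡∅ , minD)

  exchange : ∀ {X D} → IsMinimalCoModule T X → Unsplittable T X →
             IsDeltaDecomposition T D → IsDeltaDecomposition T (X ∷ avoiding X D)
  exchange {X} {D} minX unspl ((coD , disjD) , maxD , minD) =
    (proj₁ minX ∷ AllP.filter⁺ keep? coD ,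
     All.map avoids⇒disjoint (AllP.all-filter keep? D) ∷ AllPairsP.filter⁺ keep? disjD) ,
    (λ D' decD' → ℕP.≤-trans (maxD D' decD') (length-avoiding unspl D disjD minD)) ,
    minX ∷ AllP.filter⁺ keep? minD
    where
      keep? : ∀ M → Dec (¬ Meets T M X)
      keep? M = ¬? (meets? T M X)
      avoids⇒disjoint : ∀ {M} → ¬ Meets T M X → Disjoint T X M
      avoids⇒disjoint M∩X≡∅ x x∈X x∈M = M∩X≡∅ (x , x∈M , x∈X)

  module Absorb (P : Subset n → Set) (P? : ∀ X → Dec (P X))
                (P-minimal : ∀ {X} → P X → IsMinimalCoModule T X)
                (P-unsplittable : ∀ {X} → P X → Unsplittable T X)
                (P-equal-or-disjoint : ∀ {X Y} → P X → P Y → X ≡ Y ⊎ Disjoint T X Y) where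

    -- Insert the members of L one by one; a member already inserted survives
    -- later exchanges since it is equal to or disjoint from the new one.
    absorb : ∀ L D → IsDeltaDecomposition T D → (∀ X → P X → X ∈ₗ D ⊎ X ∈ₗ L) →
             ∃ λ D' → IsDeltaDecomposition T D' × (∀ X → P X → X ∈ₗ D')
    absorb [] D δD covered = D , δD , λ X PX → in-D (covered X PX)
      where
        in-D : ∀ {X} → X ∈ₗ D ⊎ X ∈ₗ [] → X ∈ₗ D
        in-D (inj₁ X∈D) = X∈D
    absorb (Y ∷ L) D δD covered with P? Y
    ... | no ¬PY = absorb L D δD covered'
      where
        covered' : ∀ X → P X → X ∈ₗ D ⊎ X ∈ₗ L
        covered' X PX with covered X PX
        ... | inj₁ X∈D = inj₁ X∈D
        ... | inj₂ (here refl) = contradiction PX ¬PY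
        ... | inj₂ (there X∈L) = inj₂ X∈L
    ... | yes PY = absorb L (Y ∷ avoiding Y D) (exchange (P-minimal PY) (P-unsplittable PY) δD) covered'
      where
        covered' : ∀ X → P X → X ∈ₗ Y ∷ avoiding Y D ⊎ X ∈ₗ L
        covered' X PX with covered X PX
        ... | inj₂ (here X≡Y) = inj₁ (here X≡Y)
        ... | inj₂ (there X∈L) = inj₂ X∈L
        ... | inj₁ X∈D with P-equal-or-disjoint PX PY
        ...   | inj₁ X≡Y = inj₁ (here X≡Y)
        ...   | inj₂ X∩Y≡∅ = inj₁ (there (∈-filter⁺ (λ M → ¬? (meets? T M Y)) X∈D
                                            λ (z , z∈X , z∈Y) → X∩Y≡∅ z z∈X z∈Y))

    absorb-all : ∀ {D} → IsDeltaDecomposition T D →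
                 ∃ λ D' → IsDeltaDecomposition T D' × (∀ X → P X → X ∈ₗ D')
    absorb-all {D} δD = absorb (allSubsets n) D δD (λ X _ → inj₂ (allSubsets-complete X))

-- Existence of δ-decompositions.

greatest : (P : ℕ → Set) → (∀ k → Dec (P k)) → P 0 → ∀ i → (∀ j → P j → j ≤ i) →
           ∃ λ k → P k × (∀ j → P j → j ≤ k)
greatest P P? P0 i bounded with P? i
... | yes Pi = i , Pi , bounded
greatest P P? P0 zero bounded | no ¬P0 = contradiction P0 ¬P0
greatest P P? P0 (suc i) bounded | no ¬Pi = greatest P P? P0 i bounded'
  where
    bounded' : ∀ j → P j → j ≤ i
    bounded' j Pj with ℕP.m≤n⇒m<n∨m≡n (bounded j Pj)
    ... | inj₁ (s≤s j≤i) = j≤i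
    ... | inj₂ refl = contradiction Pj ¬Pi

module _ {n : ℕ} (T : Tournament n) where

  Packing : ℕ → Subset n → Set
  Packing zero U = Unit
  Packing (suc k) U = ∃ λ M → IsCoModule T M × Disjoint T M U × Packing k (U ∪ M)

  packing? : ∀ k U → Dec (Packing k U)
  packing? zero U = yes tt
  packing? (suc k) U = anySubset? λ M → comodule? T M ×-dec disjoint? T M U ×-dec packing? k (U ∪ M)

  packing⇒decomposition : ∀ k U → Packing k U →
    ∃ λ D → length D ≡ k × IsCoModularDecomposition T D × All (λ M → Disjoint T M U) D
  packing⇒decomposition zero U _ = [] , refl , ([] , []) , []
  packing⇒decomposition (suc k) U (M , coM , M∩U≡∅ , packing)
    with packing⇒decomposition k (U ∪ M) packing
  ... | D , refl , (coD , disjD) , D∩U∪M≡∅ =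
    M ∷ D , refl ,
    (coM ∷ coD , All.map (λ N∩U∪M≡∅ x x∈M x∈N → N∩U∪M≡∅ x x∈N (q⊆p∪q U M x∈M)) D∩U∪M≡∅ ∷ disjD) ,
    M∩U≡∅ ∷ All.map (λ N∩U∪M≡∅ x x∈N x∈U → N∩U∪M≡∅ x x∈N (p⊆p∪q M x∈U)) D∩U∪M≡∅

  decomposition⇒packing : ∀ D U → IsCoModularDecomposition T D → All (λ M → Disjoint T M U) D →
                          Packing (length D) U
  decomposition⇒packing [] U _ _ = tt
  decomposition⇒packing (M ∷ D) U (coM ∷ coD , M∩D≡∅ ∷ disjD) (M∩U≡∅ ∷ D∩U≡∅) =
    M , coM , M∩U≡∅ ,
    decomposition⇒packing D (U ∪ M) (coD , disjD) (All.zipWith avoid-U∪M (M∩D≡∅ , D∩U≡∅))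
    where
      avoid-U∪M : ∀ {N} → Disjoint T M N × Disjoint T N U → Disjoint T N (U ∪ M)
      avoid-U∪M (M∩N≡∅ , N∩U≡∅) x x∈N x∈U∪M with x∈p∪q⁻ U M x∈U∪M
      ... | inj₁ x∈U = N∩U≡∅ x x∈N x∈U
      ... | inj₂ x∈M = M∩N≡∅ x x∈M x∈N

  -- Each co-module of a packing is nonempty, so a packing outside U has at
  -- most n - ∣ U ∣ members.
  packing-bound : ∀ k U → Packing k U → k + ∣ U ∣ ≤ n
  packing-bound zero U _ = ∣p∣≤n U
  packing-bound (suc k) U (M , coM , M∩U≡∅ , packing) = begin
    suc k + ∣ U ∣    ≡⟨ ℕP.+-suc k ∣ U ∣ ⟨
    k + suc ∣ U ∣    ≤⟨ ℕP.+-monoʳ-≤ k ∣U∣<∣U∪M∣ ⟩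
    k + ∣ U ∪ M ∣    ≤⟨ packing-bound k (U ∪ M) packing ⟩
    n                ∎
    where
      open ℕP.≤-Reasoning
      ∣U∣<∣U∪M∣ : suc ∣ U ∣ ≤ ∣ U ∪ M ∣
      ∣U∣<∣U∪M∣ = let (x , x∈M) = comodule-nonempty T coM in
                  p⊂q⇒∣p∣<∣q∣ (p⊆p∪q M , x , q⊆p∪q U M x∈M , λ x∈U → M∩U≡∅ x x∈M x∈U)

  longest-decomposition : ∃ λ D → IsCoModularDecomposition T D ×
                                  (∀ D' → IsCoModularDecomposition T D' → length D' ≤ length D)
  longest-decomposition with greatest (λ k → Packing k ⊥) (λ k → packing? k ⊥) tt n
                                      (λ j packing → ℕP.≤-trans (ℕP.m≤m+n j _) (packing-bound j ⊥ packing))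
  ... | k , packing , k-greatest with packing⇒decomposition k ⊥ packing
  ... | D , refl , decD , _ =
    D , decD , λ D' decD' → k-greatest (length D') (decomposition⇒packing D' ⊥ decD' (avoid-⊥ D'))
    where
      avoid-⊥ : ∀ D → All (λ M → Disjoint T M ⊥) D
      avoid-⊥ [] = []
      avoid-⊥ (_ ∷ D) = (λ x _ x∈⊥ → ∉⊥ x∈⊥) ∷ avoid-⊥ D

  minimal-below : ∀ M → IsCoModule T M → ∃ λ N → IsMinimalCoModule T N × N ⊆ M
  minimal-below M = go (suc ∣ M ∣) M ℕP.≤-refl
    where
      go : ∀ k M → ∣ M ∣ ℕ.< k → IsCoModule T M → ∃ λ N → IsMinimalCoModule T N × N ⊆ M
      go (suc k) M (s≤s ∣M∣≤k) coM
        with anySubset? (λ N → comodule? T N ×-dec (N ⊆? M) ×-dec ¬? (N ≟ˢ M))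
      ... | no no-smaller = M , (coM , minimal) , λ x∈M → x∈M
        where
          minimal : ∀ N → IsCoModule T N → N ⊆ M → N ≡ M
          minimal N coN N⊆M = decidable-stable (N ≟ˢ M) λ N≢M → no-smaller (N , coN , N⊆M , N≢M)
      ... | yes (N , coN , N⊆M , N≢M) =
        let (N' , minN' , N'⊆N) = go k N (ℕP.<-≤-trans (proper-subset-smaller N⊆M N≢M) ∣M∣≤k) coN
        in N' , minN' , N⊆M ∘ N'⊆N

  shrink-disjoint : ∀ {D D'} → AllPairs (Disjoint T) D → Pointwise _⊆_ D' D →
                    AllPairs (Disjoint T) D'
  shrink-disjoint [] [] = []
  shrink-disjoint {M ∷ D} {M' ∷ D'} (M∩D≡∅ ∷ disjD) (M'⊆M ∷ D'⊆D) =
    shrink-all M∩D≡∅ D'⊆D ∷ shrink-disjoint disjD D'⊆D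
    where
      shrink-all : ∀ {E E'} → All (Disjoint T M) E → Pointwise _⊆_ E' E → All (Disjoint T M') E'
      shrink-all [] [] = []
      shrink-all (M∩N≡∅ ∷ rest) (N'⊆N ∷ E'⊆E) =
        (λ x x∈M' x∈N' → M∩N≡∅ x (M'⊆M x∈M') (N'⊆N x∈N')) ∷ shrink-all rest E'⊆E

  minimal-refinement : ∀ D → All (IsCoModule T) D →
                       ∃ λ D' → Pointwise _⊆_ D' D × All (IsMinimalCoModule T) D'
  minimal-refinement [] [] = [] , [] , []
  minimal-refinement (M ∷ D) (coM ∷ coD) =
    let (N , minN , N⊆M) = minimal-below M coM
        (D' , D'⊆D , minD') = minimal-refinement D coD
    in N ∷ D' , N⊆M ∷ D'⊆D , minN ∷ minD'

  delta-decomposition-exists : ∃ λ D → IsDeltaDecomposition T D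
  delta-decomposition-exists =
    let (D , (coD , disjD) , longest) = longest-decomposition
        (D' , D'⊆D , minD') = minimal-refinement D coD
        same-length = Pointwise-length D'⊆D
    in D' , (All.map proj₁ minD' , shrink-disjoint disjD D'⊆D) ,
       (λ D'' decD'' → subst (length D'' ≤_) (sym same-length) (longest D'' decD'')) ,
       minD'

module _ {n : ℕ} (T : Tournament n) where

  -- A labeling v₀, …, v_{m+3} of a transitive component has ends v₀, v₁ and
  -- v_{m+2}, v_{m+3}; the latter are the first two vertices of the reversed
  -- labeling in the opposite tournament.
  labeling-ends : ∀ {C m} {v : Fin (suc (suc (suc (suc m)))) → Fin n} →
                  IsTransitiveComponent T C → IsLabeling T C v →
                  Ends T C (v zero) (v (suc zero))
                           (v (inject₁ (fromℕ (suc (suc m))))) (v (fromℕ (suc (suc (suc m)))))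
  labeling-ends {v = v} compC lab@(_ , v∈C , v-increasing) =
    mkEnds (labeling-head T compC lab (v∈C _) v₀≢ v₁≢)
           (labeling-head (op T) (op-component T compC) (op-labeling T lab) (v∈C (suc zero))
                          (≢-sym v₁≢) (≢-sym v₁≢))
           v₀≢
    where
      v₀≢ : ∀ {i} → v zero ≢ v (suc (suc i))
      v₀≢ = arc⇒≢ T (v-increasing zero _ (s≤s z≤n))
      v₁≢ : ∀ {i} → v (suc zero) ≢ v (suc (suc i))
      v₁≢ = arc⇒≢ T (v-increasing (suc zero) _ (s≤s (s≤s z≤n)))

  start-piece-in : ∀ {C a b c d D} → Ends T C a b c d → (∀ X → Piece T X → X ∈ₗ D) → PieceIn T a b D
  start-piece-in {C} {a} {b} {c} {d} e pieces∈D =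
    let (X , start) = startPiece-exists T a b
        piece = C , a , b , c , d , e , inj₁ start
    in X , shape start , piece-minimal T piece , pieces∈D X piece
    where
      shape : ∀ {X} → StartPiece T a b X → (X ≡ ⁅ a ⁆ ∪ ⁅ b ⁆) ⊎ (X ≡ ⁅ a ⁆) ⊎ (X ≡ ⁅ b ⁆)
      shape (inj₁ (_ , X≡a)) = inj₂ (inj₁ X≡a)
      shape (inj₂ (_ , X≡ab)) = inj₁ X≡ab

  end-piece-in : ∀ {C a b c d D} → Ends T C a b c d → (∀ X → Piece T X → X ∈ₗ D) → PieceIn T c d D
  end-piece-in {C} {a} {b} {c} {d} e pieces∈D =
    let (X , end) = startPiece-exists (op T) d c
        piece = C , a , b , c , d , e , inj₂ end
    in X , shape end , piece-minimal T piece , pieces∈D X piece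
    where
      shape : ∀ {X} → StartPiece (op T) d c X → (X ≡ ⁅ c ⁆ ∪ ⁅ d ⁆) ⊎ (X ≡ ⁅ c ⁆) ⊎ (X ≡ ⁅ d ⁆)
      shape (inj₁ (_ , X≡d)) = inj₂ (inj₂ X≡d)
      shape (inj₂ (_ , X≡dc)) = inj₁ (trans X≡dc (∪-comm ⁅ d ⁆ ⁅ c ⁆))

corollary4 : ∀ {n : ℕ} (T : Tournament n) →
    ∃ λ (D : List (Subset n)) → IsDeltaDecomposition T D ×
      (∀ (C : Subset n) → IsTransitiveComponent T C →
        ∀ (m : ℕ) (v : Fin (suc (suc (suc (suc m)))) → Fin n) → IsLabeling T C v →
          PieceIn T (v zero) (v (suc zero)) D
          × PieceIn T (v (inject₁ (fromℕ (suc (suc m))))) (v (fromℕ (suc (suc (suc m))))) D)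
corollary4 T =
  let (D , δD) = delta-decomposition-exists T
      (D' , δD' , pieces∈D') = Absorb.absorb-all T (Piece T) (piece? T) (piece-minimal T)
                                 (piece-unsplittable T) (pieces-equal-or-disjoint T) δD
  in D' , δD' , λ C compC m v lab →
       let ends = labeling-ends T compC lab
       in start-piece-in T ends pieces∈D' , end-piece-in T ends pieces∈D'
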